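{- Let $r\geq2$. Then for all $n\geq1$, $$\det(-1;F_0^{(r)},F_1^{(r)},\ldots,F_{n-1}^{(r)})=\left\lfloor\frac{2^n+2^r-2}{2^{r+1}-2}\right\rfloor.$$
   Context: For $r\ge2$, the generalized Fibonacci numbers are defined by $F_0^{(r)}=\cdots=F_{r-2}^{(r)}=0$, $F_{r-1}^{(r)}=1$, and $F_n^{(r)}=F_{n-1}^{(r)}+F_{n-2}^{(r)}+\cdots+F_{n-r}^{(r)}$ for $n\geq r$. For numbers $a_0,\ldots,a_n$, $\det(a_0;a_1,\ldots,a_n)$ denotes the determinant of the $n\times n$ Toeplitz--Hessenberg matrix whose $(i,j)$ entry is $a_{i-j+1}$ if $i-j+1\ge0$ and $0$ otherwise. -}

module Defs where

open import Data.Nat as ℕ using (ℕ; zero; suc; _∸_; _^_; _≤_; _<ᵇ_; _≡ᵇ_; NonZero)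
open import Data.Nat.Properties using (≤-trans; ^-monoʳ-≤; m<n⇒0<n∸m)
open import Data.Integer as ℤ using (ℤ; +_; -_; _*_; _+_)
open import Data.Fin using (Fin; zero; suc; toℕ; punchIn)
open import Data.List using (List; []; _∷_; take)
open import Data.Nat.ListAction using (sum)
open import Data.Bool using (if_then_else_)

-- Generalized Fibonacci numbers F^(r)_n
-- F_0 = ... = F_{r-2} = 0, F_{r-1} = 1, F_n = F_{n-1} + ... + F_{n-r} (n ≥ r)

-- next r n h : the value F^(r)_n, given h = [F_{n-1}, ..., F_0]
next : ℕ → ℕ → List ℕ → ℕ
next r n h =
  if n <ᵇ (r ∸ 1) then 0
  else if n ≡ᵇ (r ∸ 1) then 1
  else sum (take r h)

hist : ℕ → ℕ → List ℕ
hist r zero = []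
hist r (suc n) = next r n (hist r n) ∷ hist r n

F : ℕ → ℕ → ℕ
F r n = next r n (hist r n)

sumFin : ∀ n → (Fin n → ℤ) → ℤ
sumFin zero f = + 0
sumFin (suc n) f = f zero + sumFin n (λ i → f (suc i))

altSign : ℕ → ℤ
altSign zero = + 1
altSign (suc k) = - altSign k

det : ∀ n → (Fin n → Fin n → ℤ) → ℤ
det zero M = + 1
det (suc n) M =
  sumFin (suc n) λ j → altSign (toℕ j) * M zero j * det n (λ i k → M (suc i) (punchIn j k))

-- Toeplitz–Hessenberg matrix: (i,j) entry a_{i-j+1} if i-j+1 ≥ 0, else 0
-- (indices 0-based here; i-j+1 is unchanged by the shift)

toeplitzHessenberg : ∀ n → (ℕ → ℤ) → Fin n → Fin n → ℤ
toeplitzHessenberg n a i j =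
  if suc (toℕ i) <ᵇ toℕ j then + 0 else a (suc (toℕ i) ∸ toℕ j)

-- det(a_0; a_1, ..., a_n)
detTH : ∀ n → (ℕ → ℤ) → ℤ
detTH n a = det n (toeplitzHessenberg n a)

seqA : ℕ → ℕ → ℤ
seqA r zero = - (+ 1)
seqA r (suc k) = + F r k

divisorNonZero : ∀ r → 2 ≤ r → NonZero (2 ^ suc r ∸ 2)
divisorNonZero r h = ℕ.>-nonZero (m<n⇒0<n∸m (≤-trans (ℕ.s≤s (ℕ.s≤s (ℕ.s≤s ℕ.z≤n))) (^-monoʳ-≤ 2 {2} {suc r} (ℕ.s≤s (≤-trans (ℕ.s≤s ℕ.z≤n) h)))))

module Submission where

-- Let r = p + 1 ≥ 1, write F for F^(r), D n = det(-1; F_0, …, F_{n-1}) (so D 0 = 1)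
-- and E k = D (k + 1).  The proof has four parts.
--
-- (1) Hessenberg recurrence.  Expanding a Toeplitz–Hessenberg determinant whose
--     first column has been replaced by b along the first row (b_0, a_0, 0, …, 0)
--     gives, when a_0 = -1, a convolution:  D (n+1) = Σ_{i≤n} F_i · D (n-i).
-- (2) Linear recurrence for E.  Since F_0 = … = F_{p-1} = 0, F_p = 1 and F obeys
--     the r-term recurrence, the convolution yields E k = F_k for k < r and
--         E (n + r) = E n + Σ_{i<r} E (n + i).
-- (3) Doubling.  The window sums S n = Σ_{i<r} E (n + i) therefore satisfy
--     S (n+1) = 2 · S n and S 0 = 1, so S n = 2^n and E (m + r) = E m + 2^m.
-- (4) Closed form.  G k = ⌊(2^{k+1} + 2^r - 2) / (2^{r+1} - 2)⌋ has the same values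
--     below r and obeys the same recurrence, so E = G; this is the theorem.
-- Everything holds for every r ≥ 1; the theorem is the case r ≥ 2.

open import Defs
open import Data.Nat using (ℕ; zero; suc; _≤_; _<_; _+_; _*_; _∸_; _^_; z≤n; s≤s; NonZero; _<?_)
import Data.Nat as ℕ
import Data.Nat.Properties as ℕₚ
open import Data.Nat.DivMod using (_/_; m<n⇒m/n≡0; n/n≡1; m*n/n≡m; +-distrib-/-∣ʳ)
open import Data.Nat.Divisibility using (n∣m*n)
open import Data.Nat.Induction using (<-rec)
import Data.Nat.Tactic.RingSolver as ℕSolver
open import Data.Integer as ℤ using (ℤ; +_; -_)
import Data.Integer.Properties as ℤₚ
open import Data.Integer.Tactic.RingSolver using (solve-∀)
open import Data.Fin using (Fin; zero; suc; toℕ; punchIn)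
open import Data.Bool using (true; false; T; if_then_else_)
open import Data.List using (take)
open import Data.Nat.ListAction using (sum)
open import Data.Sum using (inj₁; inj₂)
open import Relation.Nullary using (¬_; yes; no)
open import Data.Empty using (⊥-elim)
open import Algebra.Properties.AbelianGroup ℤₚ.+-0-abelianGroup using (∙-cancelʳ)
open import Relation.Binary.PropositionalEquality
open ≡-Reasoning

sumFin-cong : ∀ n {f g : Fin n → ℤ} → (∀ j → f j ≡ g j) → sumFin n f ≡ sumFin n g
sumFin-cong zero    e = refl
sumFin-cong (suc n) e = cong₂ ℤ._+_ (e zero) (sumFin-cong n (λ j → e (suc j)))

sumFin-zero : ∀ n {f : Fin n → ℤ} → (∀ j → f j ≡ + 0) → sumFin n f ≡ + 0
sumFin-zero zero    e = refl
sumFin-zero (suc n) e = cong₂ ℤ._+_ (e zero) (sumFin-zero n (λ j → e (suc j)))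

det-cong : ∀ n {M N : Fin n → Fin n → ℤ} → (∀ i j → M i j ≡ N i j) → det n M ≡ det n N
det-cong zero    e = refl
det-cong (suc n) e = sumFin-cong (suc n) λ j →
  cong₂ ℤ._*_ (cong (altSign (toℕ j) ℤ.*_) (e zero j))
              (det-cong n λ i k → e (suc i) (punchIn j k))

withFirstColumn : ∀ n → (ℕ → ℤ) → (ℕ → ℤ) → Fin n → Fin n → ℤ
withFirstColumn n a b i zero    = b (toℕ i)
withFirstColumn n a b i (suc j) = toeplitzHessenberg n a i (suc j)

toeplitzHessenberg-withFirstColumn : ∀ n a i j →
  toeplitzHessenberg n a i j ≡ withFirstColumn n a (λ k → a (suc k)) i j
toeplitzHessenberg-withFirstColumn n a i zero    = refl
toeplitzHessenberg-withFirstColumn n a i (suc j) = refl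

-- First-row expansion: the first row is (b_0, a_0, 0, …, 0); deleting it and
-- column 0 leaves the Toeplitz–Hessenberg matrix of a, deleting it and column 1
-- leaves the same kind of matrix for the shifted column b ∘ suc.
withFirstColumn-expand : ∀ n a b →
  det (suc (suc n)) (withFirstColumn (suc (suc n)) a b)
    ≡ b 0 ℤ.* detTH (suc n) a ℤ.+ (- a 0) ℤ.* det (suc n) (withFirstColumn (suc n) a (λ k → b (suc k)))
withFirstColumn-expand n a b =
  twoCofactors (det-cong (suc n) minor₀) (det-cong (suc n) minor₁)
               (sumFin-zero n λ j → zeroEntry (altSign (toℕ (suc (suc j)))))
  where
  zeroEntry : ∀ s {X} → (s ℤ.* + 0) ℤ.* X ≡ + 0
  zeroEntry s {X} = cong (ℤ._* X) (ℤₚ.*-zeroʳ s)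
  twoCofactors : ∀ {X X′ Y Y′ Z} → X ≡ X′ → Y ≡ Y′ → Z ≡ + 0 →
    (+ 1 ℤ.* b 0) ℤ.* X ℤ.+ ((- + 1 ℤ.* a 0) ℤ.* Y ℤ.+ Z) ≡ b 0 ℤ.* X′ ℤ.+ (- a 0) ℤ.* Y′
  twoCofactors {X} {Y = Y} refl refl refl = lemma (b 0) X (a 0) Y
    where
    lemma : ∀ x X y Y → (+ 1 ℤ.* x) ℤ.* X ℤ.+ ((- + 1 ℤ.* y) ℤ.* Y ℤ.+ + 0) ≡ x ℤ.* X ℤ.+ (- y) ℤ.* Y
    lemma = solve-∀
  minor₀ : ∀ i k → withFirstColumn (suc (suc n)) a b (suc i) (punchIn zero k)
                   ≡ toeplitzHessenberg (suc n) a i k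
  minor₀ i zero    = refl
  minor₀ i (suc k) = refl
  minor₁ : ∀ i k → withFirstColumn (suc (suc n)) a b (suc i) (punchIn (suc zero) k)
                   ≡ withFirstColumn (suc n) a (λ k → b (suc k)) i k
  minor₁ i zero    = refl
  minor₁ i (suc k) = refl

sumBelow : ℕ → (ℕ → ℤ) → ℤ
sumBelow zero    f = + 0
sumBelow (suc k) f = f k ℤ.+ sumBelow k f

sumBelow-cong : ∀ k {f g : ℕ → ℤ} → (∀ i → i < k → f i ≡ g i) → sumBelow k f ≡ sumBelow k g
sumBelow-cong zero    e = refl
sumBelow-cong (suc k) e = cong₂ ℤ._+_ (e k ℕₚ.≤-refl) (sumBelow-cong k (λ i i<k → e i (ℕₚ.m≤n⇒m≤1+n i<k)))

sumBelow-zero : ∀ k → sumBelow k (λ _ → + 0) ≡ + 0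
sumBelow-zero zero    = refl
sumBelow-zero (suc k) = trans (ℤₚ.+-identityˡ _) (sumBelow-zero k)

sumBelow-*ʳ : ∀ k f x → sumBelow k f ℤ.* x ≡ sumBelow k (λ i → f i ℤ.* x)
sumBelow-*ʳ zero    f x = ℤₚ.*-zeroˡ x
sumBelow-*ʳ (suc k) f x =
  trans (ℤₚ.*-distribʳ-+ x (f k) (sumBelow k f)) (cong (ℤ._+_ (f k ℤ.* x)) (sumBelow-*ʳ k f x))

sumBelow-+ : ∀ k f g → sumBelow k f ℤ.+ sumBelow k g ≡ sumBelow k (λ i → f i ℤ.+ g i)
sumBelow-+ zero    f g = refl
sumBelow-+ (suc k) f g =
  trans (interchange (f k) (sumBelow k f) (g k) (sumBelow k g)) (cong (ℤ._+_ (f k ℤ.+ g k)) (sumBelow-+ k f g))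
  where
  interchange : ∀ a b c d → (a ℤ.+ b) ℤ.+ (c ℤ.+ d) ≡ (a ℤ.+ c) ℤ.+ (b ℤ.+ d)
  interchange = solve-∀

sumBelow-shift : ∀ k f → sumBelow k (λ i → f (suc i)) ℤ.+ f 0 ≡ sumBelow k f ℤ.+ f k
sumBelow-shift zero    f = refl
sumBelow-shift (suc k) f =
  trans (ℤₚ.+-assoc (f (suc k)) _ (f 0))
        (trans (cong (ℤ._+_ (f (suc k))) (sumBelow-shift k f)) (rearrange (f (suc k)) (sumBelow k f) (f k)))
  where
  rearrange : ∀ x s y → x ℤ.+ (s ℤ.+ y) ≡ (y ℤ.+ s) ℤ.+ x
  rearrange = solve-∀

convolve : ℕ → (ℕ → ℤ) → (ℕ → ℤ) → ℤ
convolve zero    b c = + 0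
convolve (suc n) b c = b 0 ℤ.* c n ℤ.+ convolve n (λ i → b (suc i)) c

convolve-cong : ∀ n {b b′} c → (∀ i → b i ≡ b′ i) → convolve n b c ≡ convolve n b′ c
convolve-cong zero    c e = refl
convolve-cong (suc n) c e = cong₂ ℤ._+_ (cong (ℤ._* c n) (e 0)) (convolve-cong n c (λ i → e (suc i)))

convolve-sumBelow : ∀ n k (b : ℕ → ℕ → ℤ) c →
  convolve n (λ i → sumBelow k (λ j → b j i)) c ≡ sumBelow k (λ j → convolve n (b j) c)
convolve-sumBelow zero    k b c = sym (sumBelow-zero k)
convolve-sumBelow (suc n) k b c = begin
    sumBelow k (λ j → b j 0) ℤ.* c n ℤ.+ convolve n (λ i → sumBelow k (λ j → b j (suc i))) c
  ≡⟨ cong₂ ℤ._+_ (sumBelow-*ʳ k (λ j → b j 0) (c n)) (convolve-sumBelow n k (λ j i → b j (suc i)) c) ⟩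
    sumBelow k (λ j → b j 0 ℤ.* c n) ℤ.+ sumBelow k (λ j → convolve n (λ i → b j (suc i)) c)
  ≡⟨ sumBelow-+ k _ _ ⟩
    sumBelow k (λ j → convolve (suc n) (b j) c)
  ∎

convolve-dropZeros : ∀ j n b c → (∀ i → i < j → b i ≡ + 0) →
  convolve (j + n) b c ≡ convolve n (λ i → b (j + i)) c
convolve-dropZeros zero    n b c z = refl
convolve-dropZeros (suc j) n b c z = begin
    b 0 ℤ.* c (j + n) ℤ.+ rest       ≡⟨ cong (λ x → x ℤ.* c (j + n) ℤ.+ rest) (z 0 (s≤s z≤n)) ⟩
    + 0 ℤ.* c (j + n) ℤ.+ rest       ≡⟨ ℤₚ.+-identityˡ rest ⟩
    rest                             ≡⟨ convolve-dropZeros j n (λ i → b (suc i)) c (λ i i<j → z (suc i) (s≤s i<j)) ⟩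
    convolve n (λ i → b (suc (j + i))) c
  ∎
  where
  rest : ℤ
  rest = convolve (j + n) (λ i → b (suc i)) c

withFirstColumn-det : ∀ a → a 0 ≡ - + 1 → ∀ n b →
  det (suc n) (withFirstColumn (suc n) a b) ≡ convolve (suc n) b (λ k → detTH k a)
withFirstColumn-det a a₀ zero b = lemma (b 0)
  where
  lemma : ∀ x → (+ 1 ℤ.* x) ℤ.* + 1 ℤ.+ + 0 ≡ x ℤ.* + 1 ℤ.+ + 0
  lemma = solve-∀
withFirstColumn-det a a₀ (suc n) b = begin
    det (suc (suc n)) (withFirstColumn (suc (suc n)) a b)
  ≡⟨ withFirstColumn-expand n a b ⟩
    b 0 ℤ.* detTH (suc n) a ℤ.+ (- a 0) ℤ.* minor
  ≡⟨ cong (λ x → b 0 ℤ.* detTH (suc n) a ℤ.+ (- x) ℤ.* minor) a₀ ⟩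
    b 0 ℤ.* detTH (suc n) a ℤ.+ + 1 ℤ.* minor
  ≡⟨ cong (ℤ._+_ (b 0 ℤ.* detTH (suc n) a))
          (trans (ℤₚ.*-identityˡ minor) (withFirstColumn-det a a₀ n (λ k → b (suc k)))) ⟩
    convolve (suc (suc n)) b (λ k → detTH k a)
  ∎
  where
  minor : ℤ
  minor = det (suc n) (withFirstColumn (suc n) a (λ k → b (suc k)))

detTH-recurrence : ∀ a → a 0 ≡ - + 1 → ∀ n →
  detTH (suc n) a ≡ convolve (suc n) (λ i → a (suc i)) (λ k → detTH k a)
detTH-recurrence a a₀ n =
  trans (det-cong (suc n) (toeplitzHessenberg-withFirstColumn (suc n) a)) (withFirstColumn-det a a₀ n (λ k → a (suc k)))

module Fibonacci (p : ℕ) where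

  r : ℕ
  r = suc p

  private
    if-true : ∀ {A : Set} {b} {x y : A} → T b → (if b then x else y) ≡ x
    if-true {b = true} _ = refl

    if-false : ∀ {A : Set} {b} {x y : A} → ¬ T b → (if b then x else y) ≡ y
    if-false {b = true}  ¬t = ⊥-elim (¬t _)
    if-false {b = false} _  = refl

    history-sum : ∀ k m → + sum (take k (hist r (m + k))) ≡ sumBelow k (λ i → + F r (m + i))
    history-sum zero    m = refl
    history-sum (suc k) m rewrite ℕₚ.+-suc m k =
      trans (ℤₚ.pos-+ (F r (m + k)) _) (cong (ℤ._+_ (+ F r (m + k))) (history-sum k m))

  F-below : ∀ k → k < p → F r k ≡ 0
  F-below k k<p = if-true (ℕₚ.<⇒<ᵇ k<p)

  F-lead : F r p ≡ 1
  F-lead = trans (if-false (λ t → ℕₚ.<-irrefl refl (ℕₚ.<ᵇ⇒< p p t)))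
                 (if-true (ℕₚ.≡⇒≡ᵇ p p refl))

  F-rec : ∀ m → + F r (m + r) ≡ sumBelow r (λ i → + F r (m + i))
  F-rec m = trans (cong +_ (trans (if-false (λ t → ℕₚ.<-asym p<m+r (ℕₚ.<ᵇ⇒< (m + r) p t)))
                                  (if-false (λ t → ℕₚ.<-irrefl (sym (ℕₚ.≡ᵇ⇒≡ (m + r) p t)) p<m+r))))
                  (history-sum r m)
    where
    p<m+r : p < m + r
    p<m+r = ℕₚ.m≤n+m r m

module DeterminantSequence (p : ℕ) where

  open Fibonacci p

  D : ℕ → ℤ
  D n = detTH n (seqA r)

  E : ℕ → ℤ
  E k = D (suc k)

  V : ℕ → ℕ → ℤ
  V n m = convolve n (λ i → + F r (m + i)) D

  E-convolve : ∀ k → E k ≡ V (suc k) 0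
  E-convolve = detTH-recurrence (seqA r) refl

  -- The zeros F_0 = … = F_{p-1} = 0 shift the start of the convolution.
  V-shift : ∀ j n m → m + j ≤ p → V (j + n) m ≡ V n (m + j)
  V-shift j n m m+j≤p =
    trans (convolve-dropZeros j n _ D λ i i<j →
             cong +_ (F-below (m + i) (ℕₚ.<-≤-trans (ℕₚ.+-monoʳ-< m i<j) m+j≤p)))
          (convolve-cong n D λ i → cong (λ x → + F r x) (sym (ℕₚ.+-assoc m j i)))

  -- The Fibonacci recurrence passes through the convolution.
  V-rec : ∀ n m → V n (m + r) ≡ sumBelow r (λ i → V n (m + i))
  V-rec n m = trans (convolve-cong n D coefficient) (convolve-sumBelow n r (λ i j → + F r (m + i + j)) D)
    where
    swap : ∀ x y z → x + y + z ≡ x + z + y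
    swap = ℕSolver.solve-∀
    coefficient : ∀ j → + F r (m + r + j) ≡ sumBelow r (λ i → + F r (m + i + j))
    coefficient j = begin
        + F r (m + r + j)       ≡⟨ cong (λ x → + F r x) (swap m r j) ⟩
        + F r (m + j + r)       ≡⟨ F-rec (m + j) ⟩
        sumBelow r (λ i → + F r (m + j + i))
                                ≡⟨ sumBelow-cong r (λ i _ → cong (λ x → + F r x) (swap m j i)) ⟩
        sumBelow r (λ i → + F r (m + i + j))
      ∎

  E-initial : ∀ k → k < r → E k ≡ + F r k
  E-initial k k<r = begin
      E k                           ≡⟨ E-convolve k ⟩
      V (suc k) 0                   ≡⟨ cong (λ x → V x 0) (ℕₚ.+-comm 1 k) ⟩
      V (k + 1) 0                   ≡⟨ V-shift k 1 0 (ℕₚ.≤-pred k<r) ⟩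
      + F r (k + 0) ℤ.* + 1 ℤ.+ + 0 ≡⟨ trans (ℤₚ.+-identityʳ _) (ℤₚ.*-identityʳ _) ⟩
      + F r (k + 0)                 ≡⟨ cong (λ x → + F r x) (ℕₚ.+-identityʳ k) ⟩
      + F r k
    ∎

  E-rec : ∀ n → E (n + r) ≡ E n ℤ.+ sumBelow r (λ i → E (n + i))
  E-rec n = begin
      E (n + r)                     ≡⟨ E-convolve (n + r) ⟩
      V (suc (n + r)) 0             ≡⟨ cong (λ x → V x 0) (reindex n p) ⟩
      V (p + suc (suc n)) 0         ≡⟨ V-shift p (suc (suc n)) 0 ℕₚ.≤-refl ⟩
      + F r (p + 0) ℤ.* D (suc n) ℤ.+ convolve (suc n) (λ i → + F r (p + suc i)) D
        ≡⟨ cong₂ ℤ._+_ (cong (λ x → + F r x ℤ.* D (suc n)) (ℕₚ.+-identityʳ p))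
                       (convolve-cong (suc n) D (λ i → cong (λ x → + F r x) (ℕₚ.+-suc p i))) ⟩
      + F r p ℤ.* E n ℤ.+ V (suc n) r
        ≡⟨ cong₂ ℤ._+_ (trans (cong (λ x → + x ℤ.* E n) F-lead) (ℤₚ.*-identityˡ (E n))) (V-rec (suc n) 0) ⟩
      E n ℤ.+ sumBelow r (λ i → V (suc n) i)
        ≡⟨ cong (ℤ._+_ (E n)) (sumBelow-cong r window) ⟩
      E n ℤ.+ sumBelow r (λ i → E (n + i))
    ∎
    where
    reindex : ∀ n p → suc (n + suc p) ≡ p + suc (suc n)
    reindex = ℕSolver.solve-∀
    window : ∀ i → i < r → V (suc n) i ≡ E (n + i)
    window i i<r = begin
      V (suc n) i           ≡⟨ V-shift i (suc n) 0 (ℕₚ.≤-pred i<r) ⟨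
      V (i + suc n) 0       ≡⟨ cong (λ x → V x 0) (trans (ℕₚ.+-suc i n) (cong suc (ℕₚ.+-comm i n))) ⟩
      V (suc (n + i)) 0     ≡⟨ E-convolve (n + i) ⟨
      E (n + i)
      ∎

  S : ℕ → ℤ
  S n = sumBelow r (λ i → E (n + i))

  S-zero : S 0 ≡ + 1
  S-zero = cong₂ ℤ._+_ (trans (E-initial p ℕₚ.≤-refl) (cong +_ F-lead))
                       (trans (sumBelow-cong p (λ i i<p → trans (E-initial i (ℕₚ.m≤n⇒m≤1+n i<p))
                                                                (cong +_ (F-below i i<p))))
                              (sumBelow-zero p))

  S-suc : ∀ n → S (suc n) ≡ S n ℤ.+ S n
  S-suc n = cancelʳ (begin
      S (suc n) ℤ.+ E n
    ≡⟨ cong₂ ℤ._+_ (sumBelow-cong r (λ i _ → cong E (sym (ℕₚ.+-suc n i))))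
                   (cong E (sym (ℕₚ.+-identityʳ n))) ⟩
      sumBelow r (λ i → E (n + suc i)) ℤ.+ E (n + 0)
    ≡⟨ sumBelow-shift r (λ i → E (n + i)) ⟩
      S n ℤ.+ E (n + r)
    ≡⟨ cong (ℤ._+_ (S n)) (E-rec n) ⟩
      S n ℤ.+ (E n ℤ.+ S n)
    ≡⟨ rearrange (S n) (E n) ⟩
      (S n ℤ.+ S n) ℤ.+ E n
    ∎)
    where
    rearrange : ∀ x y → x ℤ.+ (y ℤ.+ x) ≡ (x ℤ.+ x) ℤ.+ y
    rearrange = solve-∀
    cancelʳ : ∀ {x y} → x ℤ.+ E n ≡ y ℤ.+ E n → x ≡ y
    cancelʳ = ∙-cancelʳ (E n) _ _

  S-pow : ∀ n → S n ≡ + (2 ^ n)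
  S-pow zero    = S-zero
  S-pow (suc n) = begin
    S (suc n)                 ≡⟨ S-suc n ⟩
    S n ℤ.+ S n               ≡⟨ cong₂ ℤ._+_ (S-pow n) (S-pow n) ⟩
    + (2 ^ n) ℤ.+ + (2 ^ n)   ≡⟨ ℤₚ.pos-+ (2 ^ n) (2 ^ n) ⟨
    + (2 ^ n + 2 ^ n)         ≡⟨ cong (λ x → + (2 ^ n + x)) (ℕₚ.+-identityʳ (2 ^ n)) ⟨
    + (2 ^ suc n)
    ∎

  E-step : ∀ m → E (m + r) ≡ E m ℤ.+ + (2 ^ m)
  E-step m = trans (E-rec m) (cong (ℤ._+_ (E m)) (S-pow m))

module ClosedForm (p : ℕ) where

  r : ℕ
  r = suc p

  P : ℕ
  P = 2 ^ r ∸ 2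

  2≤2^r : 2 ≤ 2 ^ r
  2≤2^r = ℕₚ.*-monoʳ-≤ 2 (ℕₚ.m^n>0 2 p)

  P+2≡2^r : P + 2 ≡ 2 ^ r
  P+2≡2^r = ℕₚ.m∸n+n≡m 2≤2^r

  numerator : ∀ n → 2 ^ n + 2 ^ r ∸ 2 ≡ 2 ^ n + P
  numerator n = ℕₚ.+-∸-assoc (2 ^ n) 2≤2^r

  divisor : 2 ^ suc r ∸ 2 ≡ 2 * P + 2
  divisor = begin
      2 * 2 ^ r ∸ 2         ≡⟨ cong (λ x → 2 * x ∸ 2) P+2≡2^r ⟨
      2 * (P + 2) ∸ 2       ≡⟨ cong (_∸ 2) (expand P) ⟩
      (2 * P + 2) + 2 ∸ 2   ≡⟨ ℕₚ.m+n∸n≡m (2 * P + 2) 2 ⟩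
      2 * P + 2
    ∎
    where
    expand : ∀ x → 2 * (x + 2) ≡ (2 * x + 2) + 2
    expand = ℕSolver.solve-∀

  instance
    divisor-nonZero : NonZero (2 ^ suc r ∸ 2)
    divisor-nonZero = ℕ.>-nonZero (subst (0 <_) (sym divisor) (ℕₚ.<-≤-trans (s≤s z≤n) (ℕₚ.m≤n+m 2 (2 * P))))

  G : ℕ → ℕ
  G k = (2 ^ suc k + 2 ^ r ∸ 2) / (2 ^ suc r ∸ 2)

  private
    P+2+P : ∀ x → (x + 2) + x ≡ 2 * x + 2
    P+2+P = ℕSolver.solve-∀

  G-below : ∀ k → k < p → G k ≡ 0
  G-below k k<p = m<n⇒m/n≡0 (subst₂ _<_ (sym (numerator (suc k))) (trans (P+2+P P) (sym divisor))
    (ℕₚ.+-monoˡ-< P (subst (2 ^ suc k <_) (sym P+2≡2^r) (ℕₚ.^-monoʳ-< 2 (s≤s (s≤s z≤n)) (s≤s k<p)))))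

  G-lead : G p ≡ 1
  G-lead = trans (cong (_/ (2 ^ suc r ∸ 2)) numerator≡divisor) (n/n≡1 (2 ^ suc r ∸ 2))
    where
    numerator≡divisor : 2 ^ r + 2 ^ r ∸ 2 ≡ 2 ^ suc r ∸ 2
    numerator≡divisor = begin
      2 ^ r + 2 ^ r ∸ 2     ≡⟨ numerator r ⟩
      2 ^ r + P             ≡⟨ cong (_+ P) P+2≡2^r ⟨
      (P + 2) + P           ≡⟨ P+2+P P ⟩
      2 * P + 2             ≡⟨ divisor ⟨
      2 ^ suc r ∸ 2
      ∎

  -- Raising k by r adds exactly 2^k · (2^{r+1} - 2) to the numerator.
  G-step : ∀ m → G (m + r) ≡ G m + 2 ^ m
  G-step m = begin
      G (m + r)
    ≡⟨ cong (_/ d) numerator-step ⟩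
      ((2 ^ suc m + 2 ^ r ∸ 2) + 2 ^ m * d) / d
    ≡⟨ +-distrib-/-∣ʳ (2 ^ suc m + 2 ^ r ∸ 2) (n∣m*n (2 ^ m)) ⟩
      G m + 2 ^ m * d / d
    ≡⟨ cong (_+_ (G m)) (m*n/n≡m (2 ^ m) d) ⟩
      G m + 2 ^ m
    ∎
    where
    d : ℕ
    d = 2 ^ suc r ∸ 2
    expand : ∀ x y → 2 * x * (y + 2) + y ≡ (2 * x + y) + x * (2 * y + 2)
    expand = ℕSolver.solve-∀
    numerator-step : 2 ^ suc (m + r) + 2 ^ r ∸ 2 ≡ (2 ^ suc m + 2 ^ r ∸ 2) + 2 ^ m * d
    numerator-step = begin
        2 ^ suc (m + r) + 2 ^ r ∸ 2            ≡⟨ numerator (suc (m + r)) ⟩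
        2 ^ (suc m + r) + P                    ≡⟨ cong (_+ P) (ℕₚ.^-distribˡ-+-* 2 (suc m) r) ⟩
        2 * 2 ^ m * 2 ^ r + P                  ≡⟨ cong (λ x → 2 * 2 ^ m * x + P) P+2≡2^r ⟨
        2 * 2 ^ m * (P + 2) + P                ≡⟨ expand (2 ^ m) P ⟩
        (2 * 2 ^ m + P) + 2 ^ m * (2 * P + 2)  ≡⟨ cong₂ _+_ (numerator (suc m)) (cong (2 ^ m *_) divisor) ⟨
        (2 ^ suc m + 2 ^ r ∸ 2) + 2 ^ m * d
      ∎

recurrence-unique : ∀ r .{{_ : NonZero r}} {u v : ℕ → ℤ} (c : ℕ → ℤ) →
  (∀ k → k < r → u k ≡ v k) →
  (∀ m → u (m + r) ≡ u m ℤ.+ c m) → (∀ m → v (m + r) ≡ v m ℤ.+ c m) →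
  ∀ k → u k ≡ v k
recurrence-unique r {u} {v} c initial u-rec v-rec = <-rec _ agree
  where
  agree : ∀ k → (∀ {j} → j < k → u j ≡ v j) → u k ≡ v k
  agree k ih with k <? r
  ... | yes k<r = initial k k<r
  ... | no  k≮r = begin
      u k               ≡⟨ cong u m+r≡k ⟨
      u (m + r)         ≡⟨ u-rec m ⟩
      u m ℤ.+ c m       ≡⟨ cong (ℤ._+ c m) (ih m<k) ⟩
      v m ℤ.+ c m       ≡⟨ v-rec m ⟨
      v (m + r)         ≡⟨ cong v m+r≡k ⟩
      v k
    ∎
    where
    m : ℕ
    m = k ∸ r
    m+r≡k : m + r ≡ k
    m+r≡k = ℕₚ.m∸n+n≡m (ℕₚ.≮⇒≥ k≮r)
    m<k : m < k
    m<k = subst (m <_) m+r≡k (ℕₚ.m<m+n m (ℕ.>-nonZero⁻¹ r))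

detTH-closedForm : ∀ p k → detTH (suc k) (seqA (suc p)) ≡ + ClosedForm.G p k
detTH-closedForm p = recurrence-unique (suc p) (λ m → + (2 ^ m)) initial E-step closedForm-step
  where
  open Fibonacci p using (F-below; F-lead)
  open DeterminantSequence p using (E; E-initial; E-step)
  open ClosedForm p using (G; G-below; G-lead; G-step)
  initial : ∀ k → k < suc p → E k ≡ + G k
  initial k k<r with ℕₚ.m≤n⇒m<n∨m≡n (ℕₚ.≤-pred k<r)
  ... | inj₁ k<p  = trans (E-initial k k<r) (cong +_ (trans (F-below k k<p) (sym (G-below k k<p))))
  ... | inj₂ refl = trans (E-initial k k<r) (cong +_ (trans F-lead (sym G-lead)))
  closedForm-step : ∀ m → + G (m + suc p) ≡ + G m ℤ.+ + (2 ^ m)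
  closedForm-step m = trans (cong +_ (G-step m)) (ℤₚ.pos-+ (G m) (2 ^ m))

theorem12 : (r : ℕ) → (hr : 2 ≤ r) → (n : ℕ) → 1 ≤ n →
    detTH n (seqA r) ≡ + (_/_ (2 ^ n + 2 ^ r ∸ 2) (2 ^ suc r ∸ 2) {{divisorNonZero r hr}})
theorem12 .(suc (suc q)) (s≤s (s≤s {n = q} z≤n)) (suc k) _ = detTH-closedForm (suc q) k
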